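{- Let $t$ be a proof term of the system $\mathsf{LC}$ with $t : C$, and suppose $t \succ u$. Then $u : C$, and every free variable of $u$ is a free variable of $t$.
   Context: Formulas. Terms of the first-order language $\mathcal{L}$ are individual variables $\alpha,\beta,\dots$, constants, and $f(m_1,\dots,m_n)$ for function symbols $f$. Atomic formulas are $P(m_1,\dots,m_n)$ for predicate symbols $P$, including a $0$-ary symbol $\bot$; formulas are built from atomic ones with $\wedge,\vee,\to,\forall\alpha,\exists\alpha$. Proof terms of $\mathsf{LC}$ and typing (Church style; every proof variable $x^A$ carries its type; terms are taken up to renaming of bound variables). $x^A:A$. If $u:A$, $t:B$ then $\langle u,t\rangle:A\wedge B$; if $u:A\wedge B$ then $u\pi_0:A$ and $u\pi_1:B$. If $t:A\to B$, $u:A$ then $tu:B$; if $u:B$ then $\lambda x^A u:A\to B$. If $u:A$ then $\iota_0(u):A\vee B$; if $u:B$ then $\iota_1(u):A\vee B$; if $u:A\vee B$, $w_1:C$, $w_2:C$ then $u[x^A.w_1,y^B.w_2]:C$ (binding $x$ in $w_1$, $y$ in $w_2$). If $u:\forall\alpha A$ and $m$ is a term of $\mathcal L$ then $um:A[m/\alpha]$; if $u:A$ and $\alpha$ is not free in the type of any free proof variable of $u$ then $\lambda\alpha u:\forall\alpha A$. If $u:A[m/\alpha]$ then $(m,u):\exists\alpha A$; if $u:\exists\alpha A$ and $t:C$ with $\alpha$ not free in $C$ nor in the type of any free proof variable of $t$ other than $x^A$, then $u[(\alpha,x^A).t]:C$. Dummett rule: if $u:C$ and $v:C$, where the proof variable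 $a$ occurs in $u$ with type $A\to B$ and in $v$ with type $B\to A$, then $u\parallel_a v:C$, and $\parallel_a$ binds the free occurrences of $a$ in $u$ and $v$. If $u:\bot$ and $P$ is atomic then $\mathsf{efq}_P(u):P$. Stacks: a stack is a finite sequence $\sigma=\sigma_1\cdot\ldots\cdot\sigma_n$ where each $\sigma_i$ is a proof term, a term $m$ of $\mathcal L$, $\pi_0$ or $\pi_1$, $[x.u,y.v]$, or $[(\alpha,x).v]$; $\epsilon$ is the empty stack and $t\sigma$ denotes $((t\sigma_1)\sigma_2)\ldots\sigma_n$. A parallel context $\mathcal C[\,]$ is (omitting parentheses) an expression $u_1\parallel_{a_1}\cdots u_i\parallel_{a_i}[\,]\parallel_{a_{i+1}}u_{i+1}\cdots\parallel_{a_n}u_n$ with a hole $[\,]$; $\mathcal C[u]$ fills the hole with $u$. Basic reductions $\mapsto$: $(\lambda x u)t\mapsto u[t/x]$; $(\lambda\alpha u)m\mapsto u[m/\alpha]$; $\langle u_0,u_1\rangle\pi_i\mapsto u_i$; $\iota_i(u)[x_0.t_0,x_1.t_1]\mapsto t_i[u/x_i]$; $(m,u)[(\alpha,x).v]\mapsto v[m/\alpha][u/x]$; $(u\parallel_a v)w\mapsto uw\parallel_a vw$ ($a$ not free in $w$); $(u\parallel_a v)\pi_i\mapsto u\pi_i\parallel_a v\pi_i$; $(u\parallel_a v)[x.w_1,y.w_2]\mapsto u[x.w_1,y.w_2]\parallel_a v[x.w_1,y.w_2]$ ($a$ not free in $w_1,w_2$); $(u\parallel_a v)[(\alpha,x).w]\mapsto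 u[(\alpha,x).w]\parallel_a v[(\alpha,x).w]$ ($a$ not free in $w$); $\mathcal C[a^{A\to B}u\sigma]\parallel_a v\mapsto\mathcal C[v[\lambda y^B u/a^{B\to A}]]\parallel_a v$ and $v\parallel_a\mathcal C[a^{A\to B}u\sigma]\mapsto v\parallel_a\mathcal C[v[\lambda y^B u/a^{B\to A}]]$, for any parallel context $\mathcal C$, stack $\sigma$, with $a$ free in $\mathcal C[a u\sigma]$ and $y$ a dummy variable not occurring in $u$. Head reduction. Writing $t$ (without parentheses) as $t_1\parallel_{a_1}\cdots\parallel_{a_n}t_{n+1}$, each $t_i$ is a parallel process of $t$, called elementary if it is not of the form $u\parallel_a v$. A redex is a term $r$ with $r\mapsto r'$ for some $r'$. For a stack $\sigma$ and a stack $\xi$ of length one, the head redex of $t$ is: $(\lambda x u)v$ if $t=(\lambda xu)v\sigma$; $(\lambda\alpha u)m$ if $t=(\lambda\alpha u)m\sigma$; $\langle u,v\rangle\pi_i$ if $t=\langle u,v\rangle\pi_i\sigma$; $\iota_i(u)[x_1.t_1,x_2.t_2]$ if $t=\iota_i(u)[x_1.t_1,x_2.t_2]\sigma$; $(m,u)[(\alpha,x).v]$ if $t=(m,u)[(\alpha,x).v]\sigma$; $(u\parallel_a v)\xi$ if $t=(u\parallel_a v)\xi\sigma$; $t$ itself if $t=u\parallel_a v$ — in each case provided the indicated subterm is a redex. The starting symbol of a redex $r$ is its opening parenthesis if $r=(u\xi)$, and if $r=u\parallel_a v$ it is the leftmost occurrence of $a$ such that $a\,s\,\rho$ is an elementary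 process of $r$. $t\succ t'$ (head reduction) means $t'$ is obtained from $t$ by contracting, with a basic reduction, the head redex whose starting symbol is leftmost in $t$ among the head redexes of the parallel processes of $t$. -}

module Defs where

-- Conventions:
--  * "terms up to renaming of bound variables" is realised by de Bruijn indices,
--    both for individual variables (in L-terms, formulas and proof terms) and for
--    proof variables.
--  * Church-style typing of proof variables x^A is realised by a typing context
--    Γ : List Fm listing the types of the free proof variables (index i has type
--    the i-th entry); all binders carry their type annotations as in the paper.
--  * the first-order language L is an arbitrary signature.

open import Data.Nat using (ℕ; zero; suc; _+_)
open import Data.List using (List; []; _∷_; map)
open import Data.Vec using (Vec; []; _∷_)
open import Data.Vec.Relation.Unary.Any using (Any)
open import Data.Product using (Σ; ∃; _×_; _,_)
open import Data.Empty using (⊥)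
open import Relation.Binary.PropositionalEquality using (_≡_)

record Signature : Set₁ where
  field
    Fun    : Set          -- function symbols (constants = 0-ary ones)
    funAr  : Fun → ℕ
    Pred   : Set          -- predicate symbols other than ⊥
    predAr : Pred → ℕ

module LC (S : Signature) where
  open Signature S

  data Tm : Set where
    var : ℕ → Tm
    fun : (f : Fun) → Vec Tm (funAr f) → Tm

  mutual
    substT : (ℕ → Tm) → Tm → Tm
    substT σ (var x)    = σ x
    substT σ (fun f ms) = fun f (substTs σ ms)

    substTs : ∀ {n} → (ℕ → Tm) → Vec Tm n → Vec Tm n
    substTs σ []       = []
    substTs σ (m ∷ ms) = substT σ m ∷ substTs σ ms

  data FreeT (α : ℕ) : Tm → Set where
    fvar : FreeT α (var α)
    ffun : ∀ {f ms} → Any (FreeT α) ms → FreeT α (fun f ms)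

  liftI : (ℕ → Tm) → ℕ → Tm
  liftI σ zero    = var zero
  liftI σ (suc i) = substT (λ j → var (suc j)) (σ i)

  data Atom : Set where
    bot : Atom
    rel : (P : Pred) → Vec Tm (predAr P) → Atom

  infixr 30 _⇒_
  infixr 31 _∨_
  infixr 32 _∧_

  data Fm : Set where
    atom : Atom → Fm
    _∧_ _∨_ _⇒_ : Fm → Fm → Fm
    all ex : Fm → Fm        -- ∀α A , ∃α A  (α = de Bruijn index 0 in A)

  substA : (ℕ → Tm) → Atom → Atom
  substA σ bot        = bot
  substA σ (rel P ms) = rel P (substTs σ ms)

  substF : (ℕ → Tm) → Fm → Fm
  substF σ (atom P) = atom (substA σ P)
  substF σ (A ∧ B)  = substF σ A ∧ substF σ B
  substF σ (A ∨ B)  = substF σ A ∨ substF σ B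
  substF σ (A ⇒ B)  = substF σ A ⇒ substF σ B
  substF σ (all A)  = all (substF (liftI σ) A)
  substF σ (ex A)   = ex (substF (liftI σ) A)

  shiftF : Fm → Fm
  shiftF = substF (λ j → var (suc j))

  _/₀ : Tm → ℕ → Tm
  (m /₀) zero    = m
  (m /₀) (suc i) = var i

  -- A[m/α] for the body A of ∀αA / ∃αA
  inst : Fm → Tm → Fm
  inst A m = substF (m /₀) A

  data FreeA (α : ℕ) : Atom → Set where
    frel : ∀ {P ms} → Any (FreeT α) ms → FreeA α (rel P ms)

  data FreeF (α : ℕ) : Fm → Set where
    fatom : ∀ {P} → FreeA α P → FreeF α (atom P)
    f∧l : ∀ {A B} → FreeF α A → FreeF α (A ∧ B)
    f∧r : ∀ {A B} → FreeF α B → FreeF α (A ∧ B)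
    f∨l : ∀ {A B} → FreeF α A → FreeF α (A ∨ B)
    f∨r : ∀ {A B} → FreeF α B → FreeF α (A ∨ B)
    f⇒l : ∀ {A B} → FreeF α A → FreeF α (A ⇒ B)
    f⇒r : ∀ {A B} → FreeF α B → FreeF α (A ⇒ B)
    fall : ∀ {A} → FreeF (suc α) A → FreeF α (all A)
    fex  : ∀ {A} → FreeF (suc α) A → FreeF α (ex A)

  data Ix : Set where
    i0 i1 : Ix

  sel : {X : Set} → Ix → X → X → X
  sel i0 x y = x
  sel i1 x y = y

  infixl 20 _·_

  mutual
    data PT : Set where
      pv   : ℕ → PT
      ⟨_,_⟩ : PT → PT → PT
      lam  : Fm → PT → PT                -- λx^A u   (binds proof index 0)
      inj  : Ix → PT → PT
      tlam : PT → PT                     -- λα u     (binds individual index 0)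
      wit  : Tm → PT → PT
      par  : Fm → Fm → PT → PT → PT      -- par A B u v  =  u ∥_a v,
                                         --   a : A → B in u, a : B → A in v
                                         --   (binds proof index 0 in u and in v)
      efq  : Atom → PT → PT
      _·_  : PT → SE → PT

    data SE : Set where
      arg   : PT → SE
      prj   : Ix → SE
      cases : Fm → PT → Fm → PT → SE
      targ  : Tm → SE
      exE   : Fm → PT → SE               -- [(α,x^A).v]  (A under α; v under α and x)

  _◂_ : PT → List SE → PT
  t ◂ []      = t
  t ◂ (s ∷ σ) = (t · s) ◂ σ

  liftR : (ℕ → ℕ) → ℕ → ℕ
  liftR ρ zero    = zero
  liftR ρ (suc i) = suc (ρ i)

  mutual
    renP : (ℕ → ℕ) → PT → PT
    renP ρ (pv i)        = pv (ρ i)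
    renP ρ ⟨ u , v ⟩     = ⟨ renP ρ u , renP ρ v ⟩
    renP ρ (lam A u)     = lam A (renP (liftR ρ) u)
    renP ρ (inj i u)     = inj i (renP ρ u)
    renP ρ (tlam u)      = tlam (renP ρ u)
    renP ρ (wit m u)     = wit m (renP ρ u)
    renP ρ (par A B u v) = par A B (renP (liftR ρ) u) (renP (liftR ρ) v)
    renP ρ (efq P u)     = efq P (renP ρ u)
    renP ρ (u · s)       = renP ρ u · renSE ρ s

    renSE : (ℕ → ℕ) → SE → SE
    renSE ρ (arg u)             = arg (renP ρ u)
    renSE ρ (prj i)             = prj i
    renSE ρ (cases A w₁ B w₂)   = cases A (renP (liftR ρ) w₁) B (renP (liftR ρ) w₂)
    renSE ρ (targ m)            = targ m
    renSE ρ (exE A v)           = exE A (renP (liftR ρ) v)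

  mutual
    substIP : (ℕ → Tm) → PT → PT
    substIP σ (pv i)        = pv i
    substIP σ ⟨ u , v ⟩     = ⟨ substIP σ u , substIP σ v ⟩
    substIP σ (lam A u)     = lam (substF σ A) (substIP σ u)
    substIP σ (inj i u)     = inj i (substIP σ u)
    substIP σ (tlam u)      = tlam (substIP (liftI σ) u)
    substIP σ (wit m u)     = wit (substT σ m) (substIP σ u)
    substIP σ (par A B u v) = par (substF σ A) (substF σ B) (substIP σ u) (substIP σ v)
    substIP σ (efq P u)     = efq (substA σ P) (substIP σ u)
    substIP σ (u · s)       = substIP σ u · substISE σ s

    substISE : (ℕ → Tm) → SE → SE
    substISE σ (arg u)           = arg (substIP σ u)
    substISE σ (prj i)           = prj i
    substISE σ (cases A w₁ B w₂) = cases (substF σ A) (substIP σ w₁) (substF σ B) (substIP σ w₂)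
    substISE σ (targ m)          = targ (substT σ m)
    substISE σ (exE A v)         = exE (substF (liftI σ) A) (substIP (liftI σ) v)

  liftP : (ℕ → PT) → ℕ → PT
  liftP σ zero    = pv zero
  liftP σ (suc i) = renP suc (σ i)

  upI : (ℕ → PT) → ℕ → PT
  upI σ i = substIP (λ j → var (suc j)) (σ i)

  mutual
    substP : (ℕ → PT) → PT → PT
    substP σ (pv i)        = σ i
    substP σ ⟨ u , v ⟩     = ⟨ substP σ u , substP σ v ⟩
    substP σ (lam A u)     = lam A (substP (liftP σ) u)
    substP σ (inj i u)     = inj i (substP σ u)
    substP σ (tlam u)      = tlam (substP (upI σ) u)
    substP σ (wit m u)     = wit m (substP σ u)
    substP σ (par A B u v) = par A B (substP (liftP σ) u) (substP (liftP σ) v)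
    substP σ (efq P u)     = efq P (substP σ u)
    substP σ (u · s)       = substP σ u · substSE σ s

    substSE : (ℕ → PT) → SE → SE
    substSE σ (arg u)           = arg (substP σ u)
    substSE σ (prj i)           = prj i
    substSE σ (cases A w₁ B w₂) = cases A (substP (liftP σ) w₁) B (substP (liftP σ) w₂)
    substSE σ (targ m)          = targ m
    substSE σ (exE A v)         = exE A (substP (liftP (upI σ)) v)

  _/ₚ : PT → ℕ → PT
  (t /ₚ) zero    = t
  (t /ₚ) (suc i) = pv i

  mutual
    data FreeP : ℕ → PT → Set where
      fpv   : ∀ {i} → FreeP i (pv i)
      fpairl : ∀ {i u v} → FreeP i u → FreeP i ⟨ u , v ⟩
      fpairr : ∀ {i u v} → FreeP i v → FreeP i ⟨ u , v ⟩
      flam  : ∀ {i A u} → FreeP (suc i) u → FreeP i (lam A u)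
      finj  : ∀ {i j u} → FreeP i u → FreeP i (inj j u)
      ftlam : ∀ {i u} → FreeP i u → FreeP i (tlam u)
      fwit  : ∀ {i m u} → FreeP i u → FreeP i (wit m u)
      fparl : ∀ {i A B u v} → FreeP (suc i) u → FreeP i (par A B u v)
      fparr : ∀ {i A B u v} → FreeP (suc i) v → FreeP i (par A B u v)
      fefq  : ∀ {i P u} → FreeP i u → FreeP i (efq P u)
      fhd   : ∀ {i u s} → FreeP i u → FreeP i (u · s)
      fse   : ∀ {i u s} → FreePS i s → FreeP i (u · s)

    data FreePS : ℕ → SE → Set where
      farg   : ∀ {i u} → FreeP i u → FreePS i (arg u)
      fcasel : ∀ {i A w₁ B w₂} → FreeP (suc i) w₁ → FreePS i (cases A w₁ B w₂)
      fcaser : ∀ {i A w₁ B w₂} → FreeP (suc i) w₂ → FreePS i (cases A w₁ B w₂)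
      fexE   : ∀ {i A v} → FreeP (suc i) v → FreePS i (exE A v)

  mutual
    data FreeI : ℕ → PT → Set where
      ipairl : ∀ {α u v} → FreeI α u → FreeI α ⟨ u , v ⟩
      ipairr : ∀ {α u v} → FreeI α v → FreeI α ⟨ u , v ⟩
      ilamA  : ∀ {α A u} → FreeF α A → FreeI α (lam A u)
      ilam   : ∀ {α A u} → FreeI α u → FreeI α (lam A u)
      iinj   : ∀ {α j u} → FreeI α u → FreeI α (inj j u)
      itlam  : ∀ {α u} → FreeI (suc α) u → FreeI α (tlam u)
      iwitm  : ∀ {α m u} → FreeT α m → FreeI α (wit m u)
      iwit   : ∀ {α m u} → FreeI α u → FreeI α (wit m u)
      iparA  : ∀ {α A B u v} → FreeF α A → FreeI α (par A B u v)
      iparB  : ∀ {α A B u v} → FreeF α B → FreeI α (par A B u v)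
      iparl  : ∀ {α A B u v} → FreeI α u → FreeI α (par A B u v)
      iparr  : ∀ {α A B u v} → FreeI α v → FreeI α (par A B u v)
      iefqP  : ∀ {α P u} → FreeA α P → FreeI α (efq P u)
      iefq   : ∀ {α P u} → FreeI α u → FreeI α (efq P u)
      ihd    : ∀ {α u s} → FreeI α u → FreeI α (u · s)
      ise    : ∀ {α u s} → FreeIS α s → FreeI α (u · s)

    data FreeIS : ℕ → SE → Set where
      iarg    : ∀ {α u} → FreeI α u → FreeIS α (arg u)
      icasesA : ∀ {α A w₁ B w₂} → FreeF α A → FreeIS α (cases A w₁ B w₂)
      icasesB : ∀ {α A w₁ B w₂} → FreeF α B → FreeIS α (cases A w₁ B w₂)
      icasel  : ∀ {α A w₁ B w₂} → FreeI α w₁ → FreeIS α (cases A w₁ B w₂)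
      icaser  : ∀ {α A w₁ B w₂} → FreeI α w₂ → FreeIS α (cases A w₁ B w₂)
      itarg   : ∀ {α m} → FreeT α m → FreeIS α (targ m)
      iexEA   : ∀ {α A v} → FreeF (suc α) A → FreeIS α (exE A v)
      iexE    : ∀ {α A v} → FreeI (suc α) v → FreeIS α (exE A v)

  data _∋_∶_ : List Fm → ℕ → Fm → Set where
    ze : ∀ {Γ A} → (A ∷ Γ) ∋ zero ∶ A
    su : ∀ {Γ A B i} → Γ ∋ i ∶ A → (B ∷ Γ) ∋ suc i ∶ A

  infix 4 _⊢_∶_

  data _⊢_∶_ (Γ : List Fm) : PT → Fm → Set where
    tvar  : ∀ {i A} → Γ ∋ i ∶ A → Γ ⊢ pv i ∶ A
    tpair : ∀ {u t A B} → Γ ⊢ u ∶ A → Γ ⊢ t ∶ B → Γ ⊢ ⟨ u , t ⟩ ∶ A ∧ B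
    tπ₀   : ∀ {u A B} → Γ ⊢ u ∶ A ∧ B → Γ ⊢ u · prj i0 ∶ A
    tπ₁   : ∀ {u A B} → Γ ⊢ u ∶ A ∧ B → Γ ⊢ u · prj i1 ∶ B
    tapp  : ∀ {t u A B} → Γ ⊢ t ∶ A ⇒ B → Γ ⊢ u ∶ A → Γ ⊢ t · arg u ∶ B
    tlamR : ∀ {u A B} → (A ∷ Γ) ⊢ u ∶ B → Γ ⊢ lam A u ∶ A ⇒ B
    tι₀   : ∀ {u A B} → Γ ⊢ u ∶ A → Γ ⊢ inj i0 u ∶ A ∨ B
    tι₁   : ∀ {u A B} → Γ ⊢ u ∶ B → Γ ⊢ inj i1 u ∶ A ∨ B
    tcase : ∀ {u w₁ w₂ A B C} → Γ ⊢ u ∶ A ∨ B → (A ∷ Γ) ⊢ w₁ ∶ C → (B ∷ Γ) ⊢ w₂ ∶ C →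
            Γ ⊢ u · cases A w₁ B w₂ ∶ C
    tinst : ∀ {u A m} → Γ ⊢ u ∶ all A → Γ ⊢ u · targ m ∶ inst A m
    tgen  : ∀ {u A} → map shiftF Γ ⊢ u ∶ A → Γ ⊢ tlam u ∶ all A
    twit  : ∀ {u A m} → Γ ⊢ u ∶ inst A m → Γ ⊢ wit m u ∶ ex A
    texE  : ∀ {u t A C} → Γ ⊢ u ∶ ex A → (A ∷ map shiftF Γ) ⊢ t ∶ shiftF C →
            Γ ⊢ u · exE A t ∶ C
    tpar  : ∀ {u v A B C} → ((A ⇒ B) ∷ Γ) ⊢ u ∶ C → ((B ⇒ A) ∷ Γ) ⊢ v ∶ C →
            Γ ⊢ par A B u v ∶ C
    tefq  : ∀ {u P} → Γ ⊢ u ∶ atom bot → Γ ⊢ efq P u ∶ atom P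

  -- Parallel positions (= parallel contexts / parallel processes)

  data PPos : PT → Set where
    here  : ∀ {t} → PPos t
    left  : ∀ {A B u v} → PPos u → PPos (par A B u v)
    right : ∀ {A B u v} → PPos v → PPos (par A B u v)

  at : ∀ {t} → PPos t → PT
  at {t} here  = t
  at (left p)  = at p
  at (right p) = at p

  plug : ∀ {t} → PPos t → PT → PT
  plug here s = s
  plug (left {A} {B} {u} {v} p) s  = par A B (plug p s) v
  plug (right {A} {B} {u} {v} p) s = par A B u (plug p s)

  depth : ∀ {t} → PPos t → ℕ
  depth here      = zero
  depth (left p)  = suc (depth p)
  depth (right p) = suc (depth p)

  _⊕_ : ∀ {t} (p : PPos t) → PPos (at p) → PPos t
  here    ⊕ q = q
  left p  ⊕ q = left (p ⊕ q)
  right p ⊕ q = right (p ⊕ q)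

  -- left-to-right (textual) order of positions
  data _≤P_ : ∀ {t} → PPos t → PPos t → Set where
    h≤   : ∀ {t} {q : PPos t} → here ≤P q
    l≤l  : ∀ {A B u v} {p q : PPos u} → p ≤P q → left {A} {B} {u} {v} p ≤P left q
    l≤r  : ∀ {A B u v} {p : PPos u} {q : PPos v} → left {A} {B} p ≤P right q
    r≤r  : ∀ {A B u v} {p q : PPos v} → p ≤P q → right {A} {B} {u} {v} p ≤P right q

  -- the process at q is  a w σ  where a is the variable bound by the ∥ at the root
  -- (index = number of ∥-binders between that root and the position)
  AHead : ∀ {t} → PPos t → Set
  AHead q = Σ PT λ w → Σ (List SE) λ σ → at q ≡ (pv (depth q) · arg w) ◂ σ

  DLeaf : ∀ {t} → PPos t → Set
  DLeaf here      = ⊥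
  DLeaf (left q)  = AHead q
  DLeaf (right q) = AHead q

  -- v[λy^D w / a] moved into the hole at depth k:
  -- a (index 0 of v) ↦ λy^D w ; index (suc i) of v ↦ index (suc (k + i))
  dsub : ℕ → Fm → PT → ℕ → PT
  dsub k D w zero    = lam D (renP suc w)
  dsub k D w (suc i) = pv (suc (k + i))

  infix 3 _↦_

  data _↦_ : PT → PT → Set where
    βλ   : ∀ {A u t} → lam A u · arg t ↦ substP (t /ₚ) u
    βα   : ∀ {u m} → tlam u · targ m ↦ substIP (m /₀) u
    βπ   : ∀ {u₀ u₁ i} → ⟨ u₀ , u₁ ⟩ · prj i ↦ sel i u₀ u₁
    βι   : ∀ {i u A t₀ B t₁} → inj i u · cases A t₀ B t₁ ↦ substP (u /ₚ) (sel i t₀ t₁)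
    β∃   : ∀ {m u A v} → wit m u · exE A v ↦ substP (u /ₚ) (substIP (m /₀) v)
    -- permutations; the side condition "a not free in w" is realised by
    -- shifting the proof variables of the stack element past the binder a
    ∥arg : ∀ {A B u v w} → par A B u v · arg w ↦
             par A B (u · arg (renP suc w)) (v · arg (renP suc w))
    ∥prj : ∀ {A B u v i} → par A B u v · prj i ↦ par A B (u · prj i) (v · prj i)
    ∥cas : ∀ {A B u v D w₁ E w₂} → par A B u v · cases D w₁ E w₂ ↦
             par A B (u · renSE suc (cases D w₁ E w₂)) (v · renSE suc (cases D w₁ E w₂))
    ∥exE : ∀ {A B u v D w} → par A B u v · exE D w ↦
             par A B (u · renSE suc (exE D w)) (v · renSE suc (exE D w))
    -- Dummett reductions, C[ ] given by a position q
    dumL : ∀ {A B u v} (q : PPos u) {w σ} → at q ≡ (pv (depth q) · arg w) ◂ σ →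
           par A B u v ↦ par A B (plug q (substP (dsub (depth q) B w) v)) v
    dumR : ∀ {A B u v} (q : PPos v) {w σ} → at q ≡ (pv (depth q) · arg w) ◂ σ →
           par A B u v ↦ par A B u (plug q (substP (dsub (depth q) A w) u))

  -- HR s ℓ : the process s has a head redex, whose starting symbol lies at the
  -- (elementary) position ℓ of s
  data HR : (s : PT) → PPos s → Set where
    -- s = r σ with r = h ξ a redex (β-redex or permutation (u ∥_a v) ξ);
    -- starting symbol = opening parenthesis of r, at the start of s
    hrApp : ∀ {s h ξ σ r'} → s ≡ (h · ξ) ◂ σ → (h · ξ) ↦ r' → HR s here
    -- s = u ∥_a v is a redex; starting symbol = leftmost occurrence of a such
    -- that a w ρ is an elementary process of s
    hrPar : ∀ {A B u v} (ℓ : PPos (par A B u v)) →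
            (∃ λ s' → par A B u v ↦ s') →
            DLeaf ℓ → (∀ ℓ' → DLeaf ℓ' → ℓ ≤P ℓ') → HR (par A B u v) ℓ

  data Contract : PT → PT → Set where
    cApp : ∀ {h ξ σ r'} → (h · ξ) ↦ r' → Contract ((h · ξ) ◂ σ) (r' ◂ σ)
    cPar : ∀ {A B u v s'} → par A B u v ↦ s' → Contract (par A B u v) s'

  infix 3 _≻_

  -- t ≻ t' : contract the head redex (of some parallel process of t) whose
  -- starting symbol is leftmost in t
  data _≻_ (t : PT) : PT → Set where
    hstep : ∀ (p : PPos t) (ℓ : PPos (at p)) {s'} →
            HR (at p) ℓ →
            (∀ (p' : PPos t) (ℓ' : PPos (at p')) → HR (at p') ℓ' → (p ⊕ ℓ) ≤P (p' ⊕ ℓ')) →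
            Contract (at p) s' →
            t ≻ plug p s'

module Submission where

-- A head step picks a parallel process  at p  of t, contracts a redex inside it
-- and plugs the contractum back:  u = plug p s'.  Which redex is picked (the
-- leftmost head redex) is irrelevant: the statement holds for the contraction
-- of any redex in any parallel process.

open import Defs
open import Data.Nat using (ℕ; zero; suc; _+_)
open import Data.Nat.Properties using (+-suc; +-comm; +-cancelˡ-≡; suc-injective)
open import Data.List using (List; []; _∷_; map; _++_; length)
open import Data.List.Properties using (map-∘; map-cong; map-id; ++-assoc; length-++)
open import Data.Vec using (Vec; []; _∷_)
open import Data.Vec.Relation.Unary.Any using (Any; here; there)
open import Data.Product using (Σ; ∃; _×_; _,_)
open import Data.Sum using (_⊎_; inj₁; inj₂)
import Data.Sum as Sum
open import Function using (_∘_; id)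
open import Relation.Binary.PropositionalEquality

module HeadReduction (S : Signature) where
  open LC S

  ↑ᵢ : ℕ → Tm
  ↑ᵢ j = var (suc j)

  mutual
    substT-cong : ∀ {σ τ} → σ ≗ τ → substT σ ≗ substT τ
    substT-cong h (var x)    = h x
    substT-cong h (fun f ms) = cong (fun f) (substTs-cong h ms)

    substTs-cong : ∀ {σ τ n} → σ ≗ τ → substTs {n} σ ≗ substTs τ
    substTs-cong h []       = refl
    substTs-cong h (m ∷ ms) = cong₂ _∷_ (substT-cong h m) (substTs-cong h ms)

  mutual
    substT-id : substT var ≗ id
    substT-id (var x)    = refl
    substT-id (fun f ms) = cong (fun f) (substTs-id ms)

    substTs-id : ∀ {n} → substTs {n} var ≗ id
    substTs-id []       = refl
    substTs-id (m ∷ ms) = cong₂ _∷_ (substT-id m) (substTs-id ms)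

  mutual
    substT-fuse : ∀ σ τ υ → substT σ ∘ τ ≗ υ → substT σ ∘ substT τ ≗ substT υ
    substT-fuse σ τ υ h (var x)    = h x
    substT-fuse σ τ υ h (fun f ms) = cong (fun f) (substTs-fuse σ τ υ h ms)

    substTs-fuse : ∀ σ τ υ → substT σ ∘ τ ≗ υ → ∀ {n} → substTs {n} σ ∘ substTs τ ≗ substTs υ
    substTs-fuse σ τ υ h []       = refl
    substTs-fuse σ τ υ h (m ∷ ms) = cong₂ _∷_ (substT-fuse σ τ υ h m) (substTs-fuse σ τ υ h ms)

  liftI-cong : ∀ {σ τ} → σ ≗ τ → liftI σ ≗ liftI τ
  liftI-cong h zero    = refl
  liftI-cong h (suc i) = cong (substT ↑ᵢ) (h i)

  liftI-var : liftI var ≗ var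
  liftI-var zero    = refl
  liftI-var (suc i) = refl

  -- Fusion commutes with entering a binder: both sides shift the image of σ.
  liftI-fuse : ∀ σ τ υ → substT σ ∘ τ ≗ υ → substT (liftI σ) ∘ liftI τ ≗ liftI υ
  liftI-fuse σ τ υ h zero    = refl
  liftI-fuse σ τ υ h (suc j) = begin
    substT (liftI σ) (substT ↑ᵢ (τ j))  ≡⟨ substT-fuse (liftI σ) ↑ᵢ (substT ↑ᵢ ∘ σ) (λ _ → refl) (τ j) ⟩
    substT (substT ↑ᵢ ∘ σ) (τ j)         ≡⟨ sym (substT-fuse ↑ᵢ σ (substT ↑ᵢ ∘ σ) (λ _ → refl) (τ j)) ⟩
    substT ↑ᵢ (substT σ (τ j))           ≡⟨ cong (substT ↑ᵢ) (h j) ⟩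
    substT ↑ᵢ (υ j)                      ∎
    where open ≡-Reasoning

  substA-cong : ∀ {σ τ} → σ ≗ τ → substA σ ≗ substA τ
  substA-cong h bot        = refl
  substA-cong h (rel P ms) = cong (rel P) (substTs-cong h ms)

  substA-id : substA var ≗ id
  substA-id bot        = refl
  substA-id (rel P ms) = cong (rel P) (substTs-id ms)

  substA-fuse : ∀ σ τ υ → substT σ ∘ τ ≗ υ → substA σ ∘ substA τ ≗ substA υ
  substA-fuse σ τ υ h bot        = refl
  substA-fuse σ τ υ h (rel P ms) = cong (rel P) (substTs-fuse σ τ υ h ms)

  substF-cong : ∀ {σ τ} → σ ≗ τ → substF σ ≗ substF τ
  substF-cong h (atom P) = cong atom (substA-cong h P)
  substF-cong h (A ∧ B)  = cong₂ _∧_ (substF-cong h A) (substF-cong h B)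
  substF-cong h (A ∨ B)  = cong₂ _∨_ (substF-cong h A) (substF-cong h B)
  substF-cong h (A ⇒ B)  = cong₂ _⇒_ (substF-cong h A) (substF-cong h B)
  substF-cong h (all A)  = cong all (substF-cong (liftI-cong h) A)
  substF-cong h (ex A)   = cong ex (substF-cong (liftI-cong h) A)

  substF-id : substF var ≗ id
  substF-id (atom P) = cong atom (substA-id P)
  substF-id (A ∧ B)  = cong₂ _∧_ (substF-id A) (substF-id B)
  substF-id (A ∨ B)  = cong₂ _∨_ (substF-id A) (substF-id B)
  substF-id (A ⇒ B)  = cong₂ _⇒_ (substF-id A) (substF-id B)
  substF-id (all A)  = cong all (trans (substF-cong liftI-var A) (substF-id A))
  substF-id (ex A)   = cong ex (trans (substF-cong liftI-var A) (substF-id A))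

  substF-fuse : ∀ σ τ υ → substT σ ∘ τ ≗ υ → substF σ ∘ substF τ ≗ substF υ
  substF-fuse σ τ υ h (atom P) = cong atom (substA-fuse σ τ υ h P)
  substF-fuse σ τ υ h (A ∧ B)  = cong₂ _∧_ (substF-fuse σ τ υ h A) (substF-fuse σ τ υ h B)
  substF-fuse σ τ υ h (A ∨ B)  = cong₂ _∨_ (substF-fuse σ τ υ h A) (substF-fuse σ τ υ h B)
  substF-fuse σ τ υ h (A ⇒ B)  = cong₂ _⇒_ (substF-fuse σ τ υ h A) (substF-fuse σ τ υ h B)
  substF-fuse σ τ υ h (all A)  =
    cong all (substF-fuse (liftI σ) (liftI τ) (liftI υ) (liftI-fuse σ τ υ h) A)
  substF-fuse σ τ υ h (ex A)   =
    cong ex (substF-fuse (liftI σ) (liftI τ) (liftI υ) (liftI-fuse σ τ υ h) A)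

  inst-subst : ∀ ρ A m → substF ρ (inst A m) ≡ inst (substF (liftI ρ) A) (substT ρ m)
  inst-subst ρ A m =
    trans (substF-fuse ρ (m /₀) (substT ρ ∘ (m /₀)) (λ _ → refl) A)
          (sym (substF-fuse (substT ρ m /₀) (liftI ρ) (substT ρ ∘ (m /₀)) instLift A))
    where
    instLift : substT (substT ρ m /₀) ∘ liftI ρ ≗ substT ρ ∘ (m /₀)
    instLift zero    = refl
    instLift (suc j) = trans (substT-fuse (substT ρ m /₀) ↑ᵢ var (λ _ → refl) (ρ j)) (substT-id (ρ j))

  shiftF-subst : ∀ ρ B → substF (liftI ρ) (shiftF B) ≡ shiftF (substF ρ B)
  shiftF-subst ρ B = trans (substF-fuse (liftI ρ) ↑ᵢ (substT ↑ᵢ ∘ ρ) (λ _ → refl) B)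
                           (sym (substF-fuse ↑ᵢ ρ (substT ↑ᵢ ∘ ρ) (λ _ → refl) B))

  inst-shiftF : ∀ m B → inst (shiftF B) m ≡ B
  inst-shiftF m B = trans (substF-fuse (m /₀) ↑ᵢ var (λ _ → refl) B) (substF-id B)

  map-shiftF-subst : ∀ ρ Γ → map (substF (liftI ρ)) (map shiftF Γ) ≡ map shiftF (map (substF ρ) Γ)
  map-shiftF-subst ρ Γ = trans (sym (map-∘ Γ)) (trans (map-cong (shiftF-subst ρ) Γ) (map-∘ Γ))

  map-inst-shiftF : ∀ m Γ → map (substF (m /₀)) (map shiftF Γ) ≡ Γ
  map-inst-shiftF m Γ = trans (sym (map-∘ Γ)) (trans (map-cong (inst-shiftF m) Γ) (map-id Γ))

  -- A variable free in a substituted or renamed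
  --    expression stems from a variable j free in the original expression that
  --    is related to it (R j) by the substitution.

  Origin : (F R : ℕ → Set) → Set
  Origin F R = Σ ℕ λ j → F j × R j

  origin-map : ∀ {F G R Q : ℕ → Set} → (∀ {j} → F j → G j) → (∀ {j} → R j → Q j) →
               Origin F R → Origin G Q
  origin-map f g (j , x , r) = j , f x , g r

  within : ∀ {F G R : ℕ → Set} → (∀ {j} → F j → G j) → Origin F R → Origin G R
  within f = origin-map f id

  mutual
    FreeT-subst : ∀ {α ρ} m → FreeT α (substT ρ m) → Origin (λ β → FreeT β m) (λ β → FreeT α (ρ β))
    FreeT-subst (var x)    f        = x , fvar , f
    FreeT-subst (fun g ms) (ffun a) = within ffun (FreeTs-subst ms a)

    FreeTs-subst : ∀ {α ρ n} (ms : Vec Tm n) → Any (FreeT α) (substTs ρ ms) →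
                   Origin (λ β → Any (FreeT β) ms) (λ β → FreeT α (ρ β))
    FreeTs-subst (m ∷ ms) (here f)  = within here (FreeT-subst m f)
    FreeTs-subst (m ∷ ms) (there a) = within there (FreeTs-subst ms a)

  -- Leaving an individual binder: the bound variable 0 is never an origin of
  -- a free variable suc α, and the other origins go down by one.
  unbindI : ∀ {F : ℕ → Set} {ρ α} → Origin F (λ β → FreeT (suc α) (liftI ρ β)) →
            Origin (F ∘ suc) (λ β → FreeT α (ρ β))
  unbindI (zero , x , ())
  unbindI {ρ = ρ} (suc β , x , f) with FreeT-subst (ρ β) f
  ... | _ , g , fvar = β , x , g

  FreeA-subst : ∀ {α ρ} P → FreeA α (substA ρ P) → Origin (λ β → FreeA β P) (λ β → FreeT α (ρ β))
  FreeA-subst (rel P ms) (frel a) = within frel (FreeTs-subst ms a)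

  FreeF-subst : ∀ {α ρ} A → FreeF α (substF ρ A) → Origin (λ β → FreeF β A) (λ β → FreeT α (ρ β))
  FreeF-subst (atom P) (fatom f) = within fatom (FreeA-subst P f)
  FreeF-subst (A ∧ B)  (f∧l f)   = within f∧l (FreeF-subst A f)
  FreeF-subst (A ∧ B)  (f∧r f)   = within f∧r (FreeF-subst B f)
  FreeF-subst (A ∨ B)  (f∨l f)   = within f∨l (FreeF-subst A f)
  FreeF-subst (A ∨ B)  (f∨r f)   = within f∨r (FreeF-subst B f)
  FreeF-subst (A ⇒ B)  (f⇒l f)   = within f⇒l (FreeF-subst A f)
  FreeF-subst (A ⇒ B)  (f⇒r f)   = within f⇒r (FreeF-subst B f)
  FreeF-subst (all A)  (fall f)  = within fall (unbindI (FreeF-subst A f))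
  FreeF-subst (ex A)   (fex f)   = within fex (unbindI (FreeF-subst A f))

  mutual
    FreeI-substI : ∀ {α ρ} t → FreeI α (substIP ρ t) → Origin (λ β → FreeI β t) (λ β → FreeT α (ρ β))
    FreeI-substI ⟨ u , v ⟩     (ipairl f) = within ipairl (FreeI-substI u f)
    FreeI-substI ⟨ u , v ⟩     (ipairr f) = within ipairr (FreeI-substI v f)
    FreeI-substI (lam A u)     (ilamA f)  = within ilamA (FreeF-subst A f)
    FreeI-substI (lam A u)     (ilam f)   = within ilam (FreeI-substI u f)
    FreeI-substI (inj i u)     (iinj f)   = within iinj (FreeI-substI u f)
    FreeI-substI (tlam u)      (itlam f)  = within itlam (unbindI (FreeI-substI u f))
    FreeI-substI (wit m u)     (iwitm f)  = within iwitm (FreeT-subst m f)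
    FreeI-substI (wit m u)     (iwit f)   = within iwit (FreeI-substI u f)
    FreeI-substI (par A B u v) (iparA f)  = within iparA (FreeF-subst A f)
    FreeI-substI (par A B u v) (iparB f)  = within iparB (FreeF-subst B f)
    FreeI-substI (par A B u v) (iparl f)  = within iparl (FreeI-substI u f)
    FreeI-substI (par A B u v) (iparr f)  = within iparr (FreeI-substI v f)
    FreeI-substI (efq P u)     (iefqP f)  = within iefqP (FreeA-subst P f)
    FreeI-substI (efq P u)     (iefq f)   = within iefq (FreeI-substI u f)
    FreeI-substI (u · s)       (ihd f)    = within ihd (FreeI-substI u f)
    FreeI-substI (u · s)       (ise f)    = within ise (FreeIS-substI s f)

    FreeIS-substI : ∀ {α ρ} s → FreeIS α (substISE ρ s) → Origin (λ β → FreeIS β s) (λ β → FreeT α (ρ β))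
    FreeIS-substI (arg u)           (iarg f)    = within iarg (FreeI-substI u f)
    FreeIS-substI (cases A w₁ B w₂) (icasesA f) = within icasesA (FreeF-subst A f)
    FreeIS-substI (cases A w₁ B w₂) (icasesB f) = within icasesB (FreeF-subst B f)
    FreeIS-substI (cases A w₁ B w₂) (icasel f)  = within icasel (FreeI-substI w₁ f)
    FreeIS-substI (cases A w₁ B w₂) (icaser f)  = within icaser (FreeI-substI w₂ f)
    FreeIS-substI (targ m)          (itarg f)   = within itarg (FreeT-subst m f)
    FreeIS-substI (exE A v)         (iexEA f)   = within iexEA (unbindI (FreeF-subst A f))
    FreeIS-substI (exE A v)         (iexE f)    = within iexE (unbindI (FreeI-substI v f))

  mutual
    FreeP-substI : ∀ {k ρ} t → FreeP k (substIP ρ t) → FreeP k t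
    FreeP-substI (pv x)        fpv        = fpv
    FreeP-substI ⟨ u , v ⟩     (fpairl f) = fpairl (FreeP-substI u f)
    FreeP-substI ⟨ u , v ⟩     (fpairr f) = fpairr (FreeP-substI v f)
    FreeP-substI (lam A u)     (flam f)   = flam (FreeP-substI u f)
    FreeP-substI (inj i u)     (finj f)   = finj (FreeP-substI u f)
    FreeP-substI (tlam u)      (ftlam f)  = ftlam (FreeP-substI u f)
    FreeP-substI (wit m u)     (fwit f)   = fwit (FreeP-substI u f)
    FreeP-substI (par A B u v) (fparl f)  = fparl (FreeP-substI u f)
    FreeP-substI (par A B u v) (fparr f)  = fparr (FreeP-substI v f)
    FreeP-substI (efq P u)     (fefq f)   = fefq (FreeP-substI u f)
    FreeP-substI (u · s)       (fhd f)    = fhd (FreeP-substI u f)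
    FreeP-substI (u · s)       (fse f)    = fse (FreePS-substI s f)

    FreePS-substI : ∀ {k ρ} s → FreePS k (substISE ρ s) → FreePS k s
    FreePS-substI (arg u)           (farg f)   = farg (FreeP-substI u f)
    FreePS-substI (cases A w₁ B w₂) (fcasel f) = fcasel (FreeP-substI w₁ f)
    FreePS-substI (cases A w₁ B w₂) (fcaser f) = fcaser (FreeP-substI w₂ f)
    FreePS-substI (exE A v)         (fexE f)   = fexE (FreeP-substI v f)

  mutual
    FreeI-ren : ∀ {α ρ} t → FreeI α (renP ρ t) → FreeI α t
    FreeI-ren ⟨ u , v ⟩     (ipairl f) = ipairl (FreeI-ren u f)
    FreeI-ren ⟨ u , v ⟩     (ipairr f) = ipairr (FreeI-ren v f)
    FreeI-ren (lam A u)     (ilamA f)  = ilamA f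
    FreeI-ren (lam A u)     (ilam f)   = ilam (FreeI-ren u f)
    FreeI-ren (inj i u)     (iinj f)   = iinj (FreeI-ren u f)
    FreeI-ren (tlam u)      (itlam f)  = itlam (FreeI-ren u f)
    FreeI-ren (wit m u)     (iwitm f)  = iwitm f
    FreeI-ren (wit m u)     (iwit f)   = iwit (FreeI-ren u f)
    FreeI-ren (par A B u v) (iparA f)  = iparA f
    FreeI-ren (par A B u v) (iparB f)  = iparB f
    FreeI-ren (par A B u v) (iparl f)  = iparl (FreeI-ren u f)
    FreeI-ren (par A B u v) (iparr f)  = iparr (FreeI-ren v f)
    FreeI-ren (efq P u)     (iefqP f)  = iefqP f
    FreeI-ren (efq P u)     (iefq f)   = iefq (FreeI-ren u f)
    FreeI-ren (u · s)       (ihd f)    = ihd (FreeI-ren u f)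
    FreeI-ren (u · s)       (ise f)    = ise (FreeIS-ren s f)

    FreeIS-ren : ∀ {α ρ} s → FreeIS α (renSE ρ s) → FreeIS α s
    FreeIS-ren (arg u)           (iarg f)    = iarg (FreeI-ren u f)
    FreeIS-ren (cases A w₁ B w₂) (icasesA f) = icasesA f
    FreeIS-ren (cases A w₁ B w₂) (icasesB f) = icasesB f
    FreeIS-ren (cases A w₁ B w₂) (icasel f)  = icasel (FreeI-ren w₁ f)
    FreeIS-ren (cases A w₁ B w₂) (icaser f)  = icaser (FreeI-ren w₂ f)
    FreeIS-ren (targ m)          (itarg f)   = itarg f
    FreeIS-ren (exE A v)         (iexEA f)   = iexEA f
    FreeIS-ren (exE A v)         (iexE f)    = iexE (FreeI-ren v f)

  unbindR : ∀ {F : ℕ → Set} {ρ k} → Origin F (λ j → suc k ≡ liftR ρ j) → Origin (F ∘ suc) (λ j → k ≡ ρ j)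
  unbindR (zero , x , ())
  unbindR (suc j , x , e) = j , x , suc-injective e

  mutual
    FreeP-ren : ∀ {k ρ} t → FreeP k (renP ρ t) → Origin (λ j → FreeP j t) (λ j → k ≡ ρ j)
    FreeP-ren (pv x)        fpv        = x , fpv , refl
    FreeP-ren ⟨ u , v ⟩     (fpairl f) = within fpairl (FreeP-ren u f)
    FreeP-ren ⟨ u , v ⟩     (fpairr f) = within fpairr (FreeP-ren v f)
    FreeP-ren (lam A u)     (flam f)   = within flam (unbindR (FreeP-ren u f))
    FreeP-ren (inj i u)     (finj f)   = within finj (FreeP-ren u f)
    FreeP-ren (tlam u)      (ftlam f)  = within ftlam (FreeP-ren u f)
    FreeP-ren (wit m u)     (fwit f)   = within fwit (FreeP-ren u f)
    FreeP-ren (par A B u v) (fparl f)  = within fparl (unbindR (FreeP-ren u f))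
    FreeP-ren (par A B u v) (fparr f)  = within fparr (unbindR (FreeP-ren v f))
    FreeP-ren (efq P u)     (fefq f)   = within fefq (FreeP-ren u f)
    FreeP-ren (u · s)       (fhd f)    = within fhd (FreeP-ren u f)
    FreeP-ren (u · s)       (fse f)    = within fse (FreePS-ren s f)

    FreePS-ren : ∀ {k ρ} s → FreePS k (renSE ρ s) → Origin (λ j → FreePS j s) (λ j → k ≡ ρ j)
    FreePS-ren (arg u)           (farg f)   = within farg (FreeP-ren u f)
    FreePS-ren (cases A w₁ B w₂) (fcasel f) = within fcasel (unbindR (FreeP-ren w₁ f))
    FreePS-ren (cases A w₁ B w₂) (fcaser f) = within fcaser (unbindR (FreeP-ren w₂ f))
    FreePS-ren (exE A v)         (fexE f)   = within fexE (unbindR (FreeP-ren v f))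

  FreeP-weaken : ∀ {k} w → FreeP (suc k) (renP suc w) → FreeP k w
  FreeP-weaken w f with FreeP-ren w f
  ... | _ , g , refl = g

  FreePS-weaken : ∀ {k} s → FreePS (suc k) (renSE suc s) → FreePS k s
  FreePS-weaken s f with FreePS-ren s f
  ... | _ , g , refl = g

  unbindP : ∀ {F : ℕ → Set} {σ k} → Origin F (λ j → FreeP (suc k) (liftP σ j)) →
            Origin (F ∘ suc) (λ j → FreeP k (σ j))
  unbindP (zero , x , ())
  unbindP {σ = σ} (suc j , x , f) = j , x , FreeP-weaken (σ j) f

  unbindPI : ∀ {F : ℕ → Set} {σ k} → Origin F (λ j → FreeP k (upI σ j)) → Origin F (λ j → FreeP k (σ j))
  unbindPI {σ = σ} = origin-map id (λ {j} → FreeP-substI (σ j))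

  mutual
    FreeP-subst : ∀ {k} σ t → FreeP k (substP σ t) → Origin (λ j → FreeP j t) (λ j → FreeP k (σ j))
    FreeP-subst σ (pv x)        f          = x , fpv , f
    FreeP-subst σ ⟨ u , v ⟩     (fpairl f) = within fpairl (FreeP-subst σ u f)
    FreeP-subst σ ⟨ u , v ⟩     (fpairr f) = within fpairr (FreeP-subst σ v f)
    FreeP-subst σ (lam A u)     (flam f)   = within flam (unbindP (FreeP-subst (liftP σ) u f))
    FreeP-subst σ (inj i u)     (finj f)   = within finj (FreeP-subst σ u f)
    FreeP-subst σ (tlam u)      (ftlam f)  = within ftlam (unbindPI (FreeP-subst (upI σ) u f))
    FreeP-subst σ (wit m u)     (fwit f)   = within fwit (FreeP-subst σ u f)
    FreeP-subst σ (par A B u v) (fparl f)  = within fparl (unbindP (FreeP-subst (liftP σ) u f))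
    FreeP-subst σ (par A B u v) (fparr f)  = within fparr (unbindP (FreeP-subst (liftP σ) v f))
    FreeP-subst σ (efq P u)     (fefq f)   = within fefq (FreeP-subst σ u f)
    FreeP-subst σ (u · s)       (fhd f)    = within fhd (FreeP-subst σ u f)
    FreeP-subst σ (u · s)       (fse f)    = within fse (FreePS-subst σ s f)

    FreePS-subst : ∀ {k} σ s → FreePS k (substSE σ s) → Origin (λ j → FreePS j s) (λ j → FreeP k (σ j))
    FreePS-subst σ (arg u)           (farg f)   = within farg (FreeP-subst σ u f)
    FreePS-subst σ (cases A w₁ B w₂) (fcasel f) = within fcasel (unbindP (FreeP-subst (liftP σ) w₁ f))
    FreePS-subst σ (cases A w₁ B w₂) (fcaser f) = within fcaser (unbindP (FreeP-subst (liftP σ) w₂ f))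
    FreePS-subst σ (exE A v)         (fexE f)   =
      within fexE (unbindPI (unbindP (FreeP-subst (liftP (upI σ)) v f)))

  InRange : ℕ → (ℕ → PT) → Set
  InRange α σ = ∃ λ j → FreeI α (σ j)

  range-liftP : ∀ {α} σ → InRange α (liftP σ) → InRange α σ
  range-liftP σ (zero , ())
  range-liftP σ (suc j , f) = j , FreeI-ren (σ j) f

  range-upI : ∀ {α} σ → InRange (suc α) (upI σ) → InRange α σ
  range-upI σ (j , f) with FreeI-substI (σ j) f
  ... | _ , g , fvar = j , g

  mutual
    FreeI-subst : ∀ {α} σ t → FreeI α (substP σ t) → FreeI α t ⊎ InRange α σ
    FreeI-subst σ (pv x)        f          = inj₂ (x , f)
    FreeI-subst σ ⟨ u , v ⟩     (ipairl f) = Sum.map₁ ipairl (FreeI-subst σ u f)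
    FreeI-subst σ ⟨ u , v ⟩     (ipairr f) = Sum.map₁ ipairr (FreeI-subst σ v f)
    FreeI-subst σ (lam A u)     (ilamA f)  = inj₁ (ilamA f)
    FreeI-subst σ (lam A u)     (ilam f)   = Sum.map ilam (range-liftP σ) (FreeI-subst (liftP σ) u f)
    FreeI-subst σ (inj i u)     (iinj f)   = Sum.map₁ iinj (FreeI-subst σ u f)
    FreeI-subst σ (tlam u)      (itlam f)  = Sum.map itlam (range-upI σ) (FreeI-subst (upI σ) u f)
    FreeI-subst σ (wit m u)     (iwitm f)  = inj₁ (iwitm f)
    FreeI-subst σ (wit m u)     (iwit f)   = Sum.map₁ iwit (FreeI-subst σ u f)
    FreeI-subst σ (par A B u v) (iparA f)  = inj₁ (iparA f)
    FreeI-subst σ (par A B u v) (iparB f)  = inj₁ (iparB f)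
    FreeI-subst σ (par A B u v) (iparl f)  = Sum.map iparl (range-liftP σ) (FreeI-subst (liftP σ) u f)
    FreeI-subst σ (par A B u v) (iparr f)  = Sum.map iparr (range-liftP σ) (FreeI-subst (liftP σ) v f)
    FreeI-subst σ (efq P u)     (iefqP f)  = inj₁ (iefqP f)
    FreeI-subst σ (efq P u)     (iefq f)   = Sum.map₁ iefq (FreeI-subst σ u f)
    FreeI-subst σ (u · s)       (ihd f)    = Sum.map₁ ihd (FreeI-subst σ u f)
    FreeI-subst σ (u · s)       (ise f)    = Sum.map₁ ise (FreeIS-subst σ s f)

    FreeIS-subst : ∀ {α} σ s → FreeIS α (substSE σ s) → FreeIS α s ⊎ InRange α σ
    FreeIS-subst σ (arg u)           (iarg f)    = Sum.map₁ iarg (FreeI-subst σ u f)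
    FreeIS-subst σ (cases A w₁ B w₂) (icasesA f) = inj₁ (icasesA f)
    FreeIS-subst σ (cases A w₁ B w₂) (icasesB f) = inj₁ (icasesB f)
    FreeIS-subst σ (cases A w₁ B w₂) (icasel f)  =
      Sum.map icasel (range-liftP σ) (FreeI-subst (liftP σ) w₁ f)
    FreeIS-subst σ (cases A w₁ B w₂) (icaser f)  =
      Sum.map icaser (range-liftP σ) (FreeI-subst (liftP σ) w₂ f)
    FreeIS-subst σ (targ m)          (itarg f)   = inj₁ (itarg f)
    FreeIS-subst σ (exE A v)         (iexEA f)   = inj₁ (iexEA f)
    FreeIS-subst σ (exE A v)         (iexE f)    =
      Sum.map iexE (range-upI σ ∘ range-liftP (upI σ)) (FreeI-subst (liftP (upI σ)) v f)

  ∋-map : ∀ {f : Fm → Fm} {Γ i A} → Γ ∋ i ∶ A → map f Γ ∋ i ∶ f A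
  ∋-map ze     = ze
  ∋-map (su x) = su (∋-map x)

  ∋-map⁻ : ∀ {f : Fm → Fm} Γ {i B} → map f Γ ∋ i ∶ B → Σ Fm λ A → (B ≡ f A) × (Γ ∋ i ∶ A)
  ∋-map⁻ (A ∷ Γ) ze     = A , refl , ze
  ∋-map⁻ (A ∷ Γ) (su x) with ∋-map⁻ Γ x
  ... | A′ , e , y = A′ , e , su y

  Renaming : List Fm → List Fm → (ℕ → ℕ) → Set
  Renaming Γ Δ ρ = ∀ {i A} → Γ ∋ i ∶ A → Δ ∋ ρ i ∶ A

  liftR-renaming : ∀ {Γ Δ ρ B} → Renaming Γ Δ ρ → Renaming (B ∷ Γ) (B ∷ Δ) (liftR ρ)
  liftR-renaming r ze     = ze
  liftR-renaming r (su x) = su (r x)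

  map-renaming : ∀ {Γ Δ ρ} {f : Fm → Fm} → Renaming Γ Δ ρ → Renaming (map f Γ) (map f Δ) ρ
  map-renaming {Γ} r x with ∋-map⁻ Γ x
  ... | _ , refl , y = ∋-map (r y)

  ren⊢ : ∀ {Γ Δ ρ t A} → Renaming Γ Δ ρ → Γ ⊢ t ∶ A → Δ ⊢ renP ρ t ∶ A
  ren⊢ r (tvar x)        = tvar (r x)
  ren⊢ r (tpair d e)     = tpair (ren⊢ r d) (ren⊢ r e)
  ren⊢ r (tπ₀ d)         = tπ₀ (ren⊢ r d)
  ren⊢ r (tπ₁ d)         = tπ₁ (ren⊢ r d)
  ren⊢ r (tapp d e)      = tapp (ren⊢ r d) (ren⊢ r e)
  ren⊢ r (tlamR d)       = tlamR (ren⊢ (liftR-renaming r) d)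
  ren⊢ r (tι₀ d)         = tι₀ (ren⊢ r d)
  ren⊢ r (tι₁ d)         = tι₁ (ren⊢ r d)
  ren⊢ r (tcase d e₁ e₂) = tcase (ren⊢ r d) (ren⊢ (liftR-renaming r) e₁) (ren⊢ (liftR-renaming r) e₂)
  ren⊢ r (tinst d)       = tinst (ren⊢ r d)
  ren⊢ r (tgen d)        = tgen (ren⊢ (map-renaming r) d)
  ren⊢ r (twit d)        = twit (ren⊢ r d)
  ren⊢ r (texE d e)      = texE (ren⊢ r d) (ren⊢ (liftR-renaming (map-renaming r)) e)
  ren⊢ r (tpar d e)      = tpar (ren⊢ (liftR-renaming r) d) (ren⊢ (liftR-renaming r) e)
  ren⊢ r (tefq d)        = tefq (ren⊢ r d)

  substI⊢ : ∀ {Γ t A} ρ → Γ ⊢ t ∶ A → map (substF ρ) Γ ⊢ substIP ρ t ∶ substF ρ A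
  substI⊢ ρ (tvar x)        = tvar (∋-map x)
  substI⊢ ρ (tpair d e)     = tpair (substI⊢ ρ d) (substI⊢ ρ e)
  substI⊢ ρ (tπ₀ d)         = tπ₀ (substI⊢ ρ d)
  substI⊢ ρ (tπ₁ d)         = tπ₁ (substI⊢ ρ d)
  substI⊢ ρ (tapp d e)      = tapp (substI⊢ ρ d) (substI⊢ ρ e)
  substI⊢ ρ (tlamR d)       = tlamR (substI⊢ ρ d)
  substI⊢ ρ (tι₀ d)         = tι₀ (substI⊢ ρ d)
  substI⊢ ρ (tι₁ d)         = tι₁ (substI⊢ ρ d)
  substI⊢ ρ (tcase d e₁ e₂) = tcase (substI⊢ ρ d) (substI⊢ ρ e₁) (substI⊢ ρ e₂)
  substI⊢ {Γ} ρ (tinst {u} {A} {m} d) =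
    subst (map (substF ρ) Γ ⊢ substIP ρ (u · targ m) ∶_) (sym (inst-subst ρ A m)) (tinst (substI⊢ ρ d))
  substI⊢ {Γ} ρ (tgen {u} {A} d) =
    tgen (subst (_⊢ substIP (liftI ρ) u ∶ substF (liftI ρ) A) (map-shiftF-subst ρ Γ) (substI⊢ (liftI ρ) d))
  substI⊢ {Γ} ρ (twit {u} {A} {m} d) =
    twit (subst (map (substF ρ) Γ ⊢ substIP ρ u ∶_) (inst-subst ρ A m) (substI⊢ ρ d))
  substI⊢ {Γ} ρ (texE {u} {t} {A} {C} d e) =
    texE (substI⊢ ρ d)
      (subst₂ (λ Δ X → (substF (liftI ρ) A ∷ Δ) ⊢ substIP (liftI ρ) t ∶ X)
         (map-shiftF-subst ρ Γ) (shiftF-subst ρ C) (substI⊢ (liftI ρ) e))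
  substI⊢ ρ (tpar d e)      = tpar (substI⊢ ρ d) (substI⊢ ρ e)
  substI⊢ ρ (tefq d)        = tefq (substI⊢ ρ d)

  Substitution : List Fm → List Fm → (ℕ → PT) → Set
  Substitution Γ Δ σ = ∀ {i A} → Γ ∋ i ∶ A → Δ ⊢ σ i ∶ A

  liftP-substitution : ∀ {Γ Δ σ B} → Substitution Γ Δ σ → Substitution (B ∷ Γ) (B ∷ Δ) (liftP σ)
  liftP-substitution s ze     = tvar ze
  liftP-substitution s (su x) = ren⊢ su (s x)

  upI-substitution : ∀ {Γ Δ σ} → Substitution Γ Δ σ → Substitution (map shiftF Γ) (map shiftF Δ) (upI σ)
  upI-substitution {Γ} s x with ∋-map⁻ Γ x
  ... | _ , refl , y = substI⊢ ↑ᵢ (s y)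

  sub⊢ : ∀ {Γ Δ σ t A} → Substitution Γ Δ σ → Γ ⊢ t ∶ A → Δ ⊢ substP σ t ∶ A
  sub⊢ s (tvar x)        = s x
  sub⊢ s (tpair d e)     = tpair (sub⊢ s d) (sub⊢ s e)
  sub⊢ s (tπ₀ d)         = tπ₀ (sub⊢ s d)
  sub⊢ s (tπ₁ d)         = tπ₁ (sub⊢ s d)
  sub⊢ s (tapp d e)      = tapp (sub⊢ s d) (sub⊢ s e)
  sub⊢ s (tlamR d)       = tlamR (sub⊢ (liftP-substitution s) d)
  sub⊢ s (tι₀ d)         = tι₀ (sub⊢ s d)
  sub⊢ s (tι₁ d)         = tι₁ (sub⊢ s d)
  sub⊢ s (tcase d e₁ e₂) =
    tcase (sub⊢ s d) (sub⊢ (liftP-substitution s) e₁) (sub⊢ (liftP-substitution s) e₂)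
  sub⊢ s (tinst d)       = tinst (sub⊢ s d)
  sub⊢ s (tgen d)        = tgen (sub⊢ (upI-substitution s) d)
  sub⊢ s (twit d)        = twit (sub⊢ s d)
  sub⊢ s (texE d e)      = texE (sub⊢ s d) (sub⊢ (liftP-substitution (upI-substitution s)) e)
  sub⊢ s (tpar d e)      = tpar (sub⊢ (liftP-substitution s) d) (sub⊢ (liftP-substitution s) e)
  sub⊢ s (tefq d)        = tefq (sub⊢ s d)

  single-substitution : ∀ {Γ t A} → Γ ⊢ t ∶ A → Substitution (A ∷ Γ) Γ (t /ₚ)
  single-substitution d ze     = d
  single-substitution d (su x) = tvar x

  single⊢ : ∀ {Γ t u A B} → Γ ⊢ t ∶ A → (A ∷ Γ) ⊢ u ∶ B → Γ ⊢ substP (t /ₚ) u ∶ B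
  single⊢ d = sub⊢ (single-substitution d)

  stack⊢ : ∀ {Γ x y} → (∀ {D} → Γ ⊢ x ∶ D → Γ ⊢ y ∶ D) → ∀ σ {C} → Γ ⊢ x ◂ σ ∶ C → Γ ⊢ y ◂ σ ∶ C
  stack⊢ head []      d = head d
  stack⊢ {Γ} {x} {y} head (s ∷ σ) d = stack⊢ head′ σ d
    where
    head′ : ∀ {D} → Γ ⊢ x · s ∶ D → Γ ⊢ y · s ∶ D
    head′ (tπ₀ e)         = tπ₀ (head e)
    head′ (tπ₁ e)         = tπ₁ (head e)
    head′ (tapp e e′)     = tapp (head e) e′
    head′ (tcase e e₁ e₂) = tcase (head e) e₁ e₂
    head′ (tinst e)       = tinst (head e)
    head′ (texE e e′)     = texE (head e) e′

  stack-head⊢ : ∀ {Γ x} σ {C} → Γ ⊢ x ◂ σ ∶ C → Σ Fm λ D → Γ ⊢ x ∶ D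
  stack-head⊢ []      d = _ , d
  stack-head⊢ (s ∷ σ) d with stack-head⊢ σ d
  ... | _ , tπ₀ e       = _ , e
  ... | _ , tπ₁ e       = _ , e
  ... | _ , tapp e _    = _ , e
  ... | _ , tcase e _ _ = _ , e
  ... | _ , tinst e     = _ , e
  ... | _ , texE e _    = _ , e

  stack-freeP : ∀ {x y} → (∀ {k} → FreeP k y → FreeP k x) → ∀ σ {k} → FreeP k (y ◂ σ) → FreeP k (x ◂ σ)
  stack-freeP head []      f = head f
  stack-freeP {x} {y} head (s ∷ σ) f = stack-freeP head′ σ f
    where
    head′ : ∀ {k} → FreeP k (y · s) → FreeP k (x · s)
    head′ (fhd g) = fhd (head g)
    head′ (fse g) = fse g

  stack-freeI : ∀ {x y} → (∀ {α} → FreeI α y → FreeI α x) → ∀ σ {α} → FreeI α (y ◂ σ) → FreeI α (x ◂ σ)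
  stack-freeI head []      f = head f
  stack-freeI {x} {y} head (s ∷ σ) f = stack-freeI head′ σ f
    where
    head′ : ∀ {α} → FreeI α (y · s) → FreeI α (x · s)
    head′ (ihd g) = ihd (head g)
    head′ (ise g) = ise g

  head-freeP : ∀ {x k} σ → FreeP k x → FreeP k (x ◂ σ)
  head-freeP []      f = f
  head-freeP (s ∷ σ) f = head-freeP σ (fhd f)

  head-freeI : ∀ {x α} σ → FreeI α x → FreeI α (x ◂ σ)
  head-freeI []      f = f
  head-freeI (s ∷ σ) f = head-freeI σ (ihd f)

  -- The process at p lives under the ∥-binders above
  --    p: a focus records their types (innermost first), a typing of the
  --    process in the extended context, and how a process typed there is put
  --    back in the hole.

  record Focus (Γ : List Fm) (C : Fm) (n : ℕ) (s : PT) (fill : PT → PT) : Set where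
    field
      binders        : List Fm
      binders-length : length binders ≡ n
      focus⊢         : binders ++ Γ ⊢ s ∶ C
      refill⊢        : ∀ {s′} → binders ++ Γ ⊢ s′ ∶ C → Γ ⊢ fill s′ ∶ C

  enter-branch : ∀ {Γ Z C n s fill fill′} → Focus (Z ∷ Γ) C n s fill →
                 (∀ {s′} → (Z ∷ Γ) ⊢ fill s′ ∶ C → Γ ⊢ fill′ s′ ∶ C) → Focus Γ C (suc n) s fill′
  enter-branch {Γ} {Z} {C} F close = record
    { binders        = binders ++ Z ∷ []
    ; binders-length = trans (length-++ binders) (trans (+-comm (length binders) 1) (cong suc binders-length))
    ; focus⊢         = subst (_⊢ _ ∶ C) (sym reassoc) focus⊢
    ; refill⊢        = λ e → close (refill⊢ (subst (_⊢ _ ∶ C) reassoc e))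
    }
    where
    open Focus F
    reassoc : (binders ++ Z ∷ []) ++ Γ ≡ binders ++ Z ∷ Γ
    reassoc = ++-assoc binders (Z ∷ []) Γ

  focus-at : ∀ {Γ t C} → Γ ⊢ t ∶ C → (p : PPos t) → Focus Γ C (depth p) (at p) (plug p)
  focus-at d here = record { binders = [] ; binders-length = refl ; focus⊢ = d ; refill⊢ = λ e → e }
  focus-at (tpar d₁ d₂) (left p)  = enter-branch (focus-at d₁ p) (λ e → tpar e d₂)
  focus-at (tpar d₁ d₂) (right p) = enter-branch (focus-at d₂ p) (tpar d₁)

  at-freeP : ∀ {t j} (p : PPos t) → FreeP (depth p + j) (at p) → FreeP j t
  at-freeP here f = f
  at-freeP {j = j} (left p)  f = fparl (at-freeP p (subst (λ n → FreeP n (at p)) (sym (+-suc (depth p) j)) f))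
  at-freeP {j = j} (right p) f = fparr (at-freeP p (subst (λ n → FreeP n (at p)) (sym (+-suc (depth p) j)) f))

  plug-freeP : ∀ {t s j} (p : PPos t) → FreeP j (plug p s) → FreeP j t ⊎ FreeP (depth p + j) s
  plug-freeP here f = inj₂ f
  plug-freeP {s = s} {j} (left p) (fparl f) =
    Sum.map fparl (subst (λ n → FreeP n s) (+-suc (depth p) j)) (plug-freeP p f)
  plug-freeP (left p)  (fparr f) = inj₁ (fparr f)
  plug-freeP (right p) (fparl f) = inj₁ (fparl f)
  plug-freeP {s = s} {j} (right p) (fparr f) =
    Sum.map fparr (subst (λ n → FreeP n s) (+-suc (depth p) j)) (plug-freeP p f)

  at-freeI : ∀ {t α} (p : PPos t) → FreeI α (at p) → FreeI α t
  at-freeI here      f = f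
  at-freeI (left p)  f = iparl (at-freeI p f)
  at-freeI (right p) f = iparr (at-freeI p f)

  plug-freeI : ∀ {t s α} (p : PPos t) → FreeI α (plug p s) → FreeI α t ⊎ FreeI α s
  plug-freeI here      f         = inj₂ f
  plug-freeI (left p)  (iparA f) = inj₁ (iparA f)
  plug-freeI (left p)  (iparB f) = inj₁ (iparB f)
  plug-freeI (left p)  (iparl f) = Sum.map₁ iparl (plug-freeI p f)
  plug-freeI (left p)  (iparr f) = inj₁ (iparr f)
  plug-freeI (right p) (iparA f) = inj₁ (iparA f)
  plug-freeI (right p) (iparB f) = inj₁ (iparB f)
  plug-freeI (right p) (iparl f) = inj₁ (iparl f)
  plug-freeI (right p) (iparr f) = Sum.map₁ iparr (plug-freeI p f)

  refill-freeP : ∀ {t s j} (p : PPos t) → (∀ {k} → FreeP k s → FreeP k (at p)) →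
                 FreeP j (plug p s) → FreeP j t
  refill-freeP p back f = Sum.[ id , at-freeP p ∘ back ] (plug-freeP p f)

  refill-freeI : ∀ {t s α} (p : PPos t) → (∀ {β} → FreeI β s → FreeI β (at p)) →
                 FreeI α (plug p s) → FreeI α t
  refill-freeI p back f = Sum.[ id , at-freeI p ∘ back ] (plug-freeI p f)

  -- The Dummett reduction  C[a w σ] ∥_a v ↦ C[v[λy.w/a]] ∥_a v.  Here q is
  --     the position of the hole in u; inside it a is the variable depth q,
  --     and dsub (depth q) Y w substitutes λy^Y.w for a in v while moving the
  --     other variables of v past the depth q binders above the hole.

  ∋-outer : ∀ {Γ k E Z} (Θ : List Fm) → Γ ∋ k ∶ E → (Θ ++ Z ∷ Γ) ∋ suc (length Θ + k) ∶ E
  ∋-outer []      x = su x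
  ∋-outer (F ∷ Θ) x = su (∋-outer Θ x)

  ∋-middle : ∀ {Γ E Z} (Θ : List Fm) → (Θ ++ Z ∷ Γ) ∋ length Θ ∶ E → Z ≡ E
  ∋-middle []      ze     = refl
  ∋-middle (F ∷ Θ) (su x) = ∋-middle Θ x

  argument⊢ : ∀ {Γ X Y w σ C n} (Θ : List Fm) → length Θ ≡ n →
              Θ ++ (X ⇒ Y) ∷ Γ ⊢ (pv n · arg w) ◂ σ ∶ C → Θ ++ (X ⇒ Y) ∷ Γ ⊢ w ∶ X
  argument⊢ {σ = σ} Θ refl d with stack-head⊢ σ d
  ... | _ , tapp (tvar x) dw with ∋-middle Θ x
  ... | refl = dw

  dummett-substitution : ∀ {Γ X Y w n} (Θ : List Fm) → length Θ ≡ n →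
                         Θ ++ (X ⇒ Y) ∷ Γ ⊢ w ∶ X →
                         Substitution ((Y ⇒ X) ∷ Γ) (Θ ++ (X ⇒ Y) ∷ Γ) (dsub n Y w)
  dummett-substitution Θ len  dw ze     = tlamR (ren⊢ su dw)
  dummett-substitution Θ refl dw (su x) = tvar (∋-outer Θ x)

  dummett⊢ : ∀ {Γ X Y u v w σ C} (q : PPos u) → at q ≡ (pv (depth q) · arg w) ◂ σ →
             ((X ⇒ Y) ∷ Γ) ⊢ u ∶ C → ((Y ⇒ X) ∷ Γ) ⊢ v ∶ C →
             ((X ⇒ Y) ∷ Γ) ⊢ plug q (substP (dsub (depth q) Y w) v) ∶ C
  dummett⊢ {σ = σ} {C} q eq du dv =
    refill⊢ (sub⊢ (dummett-substitution binders binders-length dw) dv)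
    where
    open Focus (focus-at du q)
    dw = argument⊢ {σ = σ} binders binders-length (subst (λ z → binders ++ _ ⊢ z ∶ C) eq focus⊢)

  argument-freeP : ∀ {u w σ k} (q : PPos u) → at q ≡ (pv (depth q) · arg w) ◂ σ →
                   FreeP (depth q + k) w → FreeP k u
  argument-freeP {σ = σ} q eq f = at-freeP q (subst (FreeP _) (sym eq) (head-freeP σ (fse (farg f))))

  argument-freeI : ∀ {u w σ α} (q : PPos u) → at q ≡ (pv (depth q) · arg w) ◂ σ →
                   FreeI α w → FreeI α u
  argument-freeI {σ = σ} q eq f = at-freeI q (subst (FreeI _) (sym eq) (head-freeI σ (ise (iarg f))))

  pv-freeP : ∀ {a b} → FreeP a (pv b) → a ≡ b
  pv-freeP fpv = refl

  dsub-outer : ∀ {n k} j → FreeP (n + k) (pv (suc (n + j))) → k ≡ suc j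
  dsub-outer {n} {k} j f = +-cancelˡ-≡ n k (suc j) (trans (pv-freeP f) (sym (+-suc n j)))

  dummett-freeP : ∀ {Y u v w σ k} (q : PPos u) → at q ≡ (pv (depth q) · arg w) ◂ σ →
                  FreeP k (plug q (substP (dsub (depth q) Y w) v)) → FreeP k u ⊎ FreeP k v
  dummett-freeP {Y} {v = v} {w} {σ} q eq f with plug-freeP q f
  ... | inj₁ g = inj₁ g
  ... | inj₂ g with FreeP-subst (dsub (depth q) Y w) v g
  ... | zero  , _ , flam h = inj₁ (argument-freeP {σ = σ} q eq (FreeP-weaken w h))
  ... | suc j , g′ , h     = inj₂ (subst (λ n → FreeP n v) (sym (dsub-outer j h)) g′)

  dummett-freeI : ∀ {Y u v w σ α} (q : PPos u) → at q ≡ (pv (depth q) · arg w) ◂ σ →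
                  FreeI α (plug q (substP (dsub (depth q) Y w) v)) → FreeI α u ⊎ (FreeI α v ⊎ FreeF α Y)
  dummett-freeI {Y} {v = v} {w} {σ} q eq f with plug-freeI q f
  ... | inj₁ g = inj₁ g
  ... | inj₂ g with FreeI-subst (dsub (depth q) Y w) v g
  ... | inj₁ h                = inj₂ (inj₁ h)
  ... | inj₂ (zero , ilamA h) = inj₂ (inj₂ h)
  ... | inj₂ (zero , ilam h)  = inj₁ (argument-freeI {σ = σ} q eq (FreeI-ren w h))
  ... | inj₂ (suc j , ())

  basic⊢ : ∀ {Γ x y C} → x ↦ y → Γ ⊢ x ∶ C → Γ ⊢ y ∶ C
  basic⊢ βλ (tapp (tlamR d) e) = single⊢ e d
  basic⊢ {Γ} (βα {u} {m}) (tinst {A = A} (tgen d)) =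
    subst (_⊢ substIP (m /₀) u ∶ inst A m) (map-inst-shiftF m Γ) (substI⊢ (m /₀) d)
  basic⊢ βπ (tπ₀ (tpair d e))          = d
  basic⊢ βπ (tπ₁ (tpair d e))          = e
  basic⊢ βι (tcase (tι₀ d) e₁ e₂)      = single⊢ d e₁
  basic⊢ βι (tcase (tι₁ d) e₁ e₂)      = single⊢ d e₂
  basic⊢ {Γ} (β∃ {m} {u} {A} {v}) (texE {C = C} (twit d) e) =
    single⊢ d (subst₂ (λ Δ X → (inst A m ∷ Δ) ⊢ substIP (m /₀) v ∶ X)
                      (map-inst-shiftF m Γ) (inst-shiftF m C) (substI⊢ (m /₀) e))
  basic⊢ ∥arg (tapp (tpar d₁ d₂) e)    = tpar (tapp d₁ (ren⊢ su e)) (tapp d₂ (ren⊢ su e))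
  basic⊢ ∥prj (tπ₀ (tpar d₁ d₂))       = tpar (tπ₀ d₁) (tπ₀ d₂)
  basic⊢ ∥prj (tπ₁ (tpar d₁ d₂))       = tpar (tπ₁ d₁) (tπ₁ d₂)
  basic⊢ ∥cas (tcase (tpar d₁ d₂) e₁ e₂) =
    tpar (tcase d₁ (ren⊢ (liftR-renaming su) e₁) (ren⊢ (liftR-renaming su) e₂))
         (tcase d₂ (ren⊢ (liftR-renaming su) e₁) (ren⊢ (liftR-renaming su) e₂))
  basic⊢ ∥exE (texE (tpar d₁ d₂) e)    =
    tpar (texE d₁ (ren⊢ (liftR-renaming su) e)) (texE d₂ (ren⊢ (liftR-renaming su) e))
  basic⊢ (dumL q {σ = σ} eq) (tpar d₁ d₂) = tpar (dummett⊢ {σ = σ} q eq d₁ d₂) d₂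
  basic⊢ (dumR q {σ = σ} eq) (tpar d₁ d₂) = tpar d₁ (dummett⊢ {σ = σ} q eq d₂ d₁)

  -- The β-rules substitute
  --     for a bound variable, which contributes the free variables of the
  --     substituted term; a ∥-permutation pushes a stack element ξ, weakened
  --     past the ∥-binder, into both branches.

  single-freeP : ∀ {k} t u → FreeP k (substP (t /ₚ) u) → FreeP (suc k) u ⊎ FreeP k t
  single-freeP t u f with FreeP-subst (t /ₚ) u f
  ... | zero  , _ , h   = inj₂ h
  ... | suc j , g , fpv = inj₁ g

  single-freeI : ∀ {α} t u → FreeI α (substP (t /ₚ) u) → FreeI α u ⊎ FreeI α t
  single-freeI t u f with FreeI-subst (t /ₚ) u f
  ... | inj₁ g           = inj₁ g
  ... | inj₂ (zero , g)  = inj₂ g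
  ... | inj₂ (suc j , ())

  inst-freeI : ∀ {α m} u → FreeI α (substIP (m /₀) u) → FreeI (suc α) u ⊎ FreeT α m
  inst-freeI u f with FreeI-substI u f
  ... | zero  , _ , h    = inj₂ h
  ... | suc β , g , fvar = inj₁ g

  permute-freeP : ∀ {A B u v k} ξ → FreeP k (par A B (u · renSE suc ξ) (v · renSE suc ξ)) →
                  FreeP k (par A B u v · ξ)
  permute-freeP ξ (fparl (fhd f)) = fhd (fparl f)
  permute-freeP ξ (fparl (fse f)) = fse (FreePS-weaken ξ f)
  permute-freeP ξ (fparr (fhd f)) = fhd (fparr f)
  permute-freeP ξ (fparr (fse f)) = fse (FreePS-weaken ξ f)

  permute-freeI : ∀ {A B u v α} ξ → FreeI α (par A B (u · renSE suc ξ) (v · renSE suc ξ)) →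
                  FreeI α (par A B u v · ξ)
  permute-freeI ξ (iparA f)       = ihd (iparA f)
  permute-freeI ξ (iparB f)       = ihd (iparB f)
  permute-freeI ξ (iparl (ihd f)) = ihd (iparl f)
  permute-freeI ξ (iparl (ise f)) = ise (FreeIS-ren ξ f)
  permute-freeI ξ (iparr (ihd f)) = ihd (iparr f)
  permute-freeI ξ (iparr (ise f)) = ise (FreeIS-ren ξ f)

  basic-freeP : ∀ {x y k} → x ↦ y → FreeP k y → FreeP k x
  basic-freeP (βλ {u = u} {t}) f = Sum.[ fhd ∘ flam , fse ∘ farg ] (single-freeP t u f)
  basic-freeP (βα {u})         f = fhd (ftlam (FreeP-substI u f))
  basic-freeP (βπ {i = i0})    f = fhd (fpairl f)
  basic-freeP (βπ {i = i1})    f = fhd (fpairr f)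
  basic-freeP (βι {i0} {u} {t₀ = t₀}) f = Sum.[ fse ∘ fcasel , fhd ∘ finj ] (single-freeP u t₀ f)
  basic-freeP (βι {i1} {u} {t₁ = t₁}) f = Sum.[ fse ∘ fcaser , fhd ∘ finj ] (single-freeP u t₁ f)
  basic-freeP (β∃ {m} {u} {v = v}) f =
    Sum.[ fse ∘ fexE ∘ FreeP-substI v , fhd ∘ fwit ] (single-freeP u (substIP (m /₀) v) f)
  basic-freeP (∥arg {w = w})               = permute-freeP (arg w)
  basic-freeP (∥prj {i = i})               = permute-freeP (prj i)
  basic-freeP (∥cas {D = D} {w₁} {E} {w₂}) = permute-freeP (cases D w₁ E w₂)
  basic-freeP (∥exE {D = D} {w})           = permute-freeP (exE D w)
  basic-freeP (dumL q {σ = σ} eq) (fparl f) = Sum.[ fparl , fparr ] (dummett-freeP {σ = σ} q eq f)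
  basic-freeP (dumL q eq)         (fparr f) = fparr f
  basic-freeP (dumR q eq)         (fparl f) = fparl f
  basic-freeP (dumR q {σ = σ} eq) (fparr f) = Sum.[ fparr , fparl ] (dummett-freeP {σ = σ} q eq f)

  basic-freeI : ∀ {x y α} → x ↦ y → FreeI α y → FreeI α x
  basic-freeI (βλ {u = u} {t}) f = Sum.[ ihd ∘ ilam , ise ∘ iarg ] (single-freeI t u f)
  basic-freeI (βα {u})         f = Sum.[ ihd ∘ itlam , ise ∘ itarg ] (inst-freeI u f)
  basic-freeI (βπ {i = i0})    f = ihd (ipairl f)
  basic-freeI (βπ {i = i1})    f = ihd (ipairr f)
  basic-freeI (βι {i0} {u} {t₀ = t₀}) f = Sum.[ ise ∘ icasel , ihd ∘ iinj ] (single-freeI u t₀ f)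
  basic-freeI (βι {i1} {u} {t₁ = t₁}) f = Sum.[ ise ∘ icaser , ihd ∘ iinj ] (single-freeI u t₁ f)
  basic-freeI (β∃ {m} {u} {v = v}) f =
    Sum.[ Sum.[ ise ∘ iexE , ihd ∘ iwitm ] ∘ inst-freeI v , ihd ∘ iwit ] (single-freeI u (substIP (m /₀) v) f)
  basic-freeI (∥arg {w = w})               = permute-freeI (arg w)
  basic-freeI (∥prj {i = i})               = permute-freeI (prj i)
  basic-freeI (∥cas {D = D} {w₁} {E} {w₂}) = permute-freeI (cases D w₁ E w₂)
  basic-freeI (∥exE {D = D} {w})           = permute-freeI (exE D w)
  basic-freeI (dumL q eq) (iparA f) = iparA f
  basic-freeI (dumL q eq) (iparB f) = iparB f
  basic-freeI (dumL q {σ = σ} eq) (iparl f) =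
    Sum.[ iparl , Sum.[ iparr , iparB ] ] (dummett-freeI {σ = σ} q eq f)
  basic-freeI (dumL q eq) (iparr f) = iparr f
  basic-freeI (dumR q eq) (iparA f) = iparA f
  basic-freeI (dumR q eq) (iparB f) = iparB f
  basic-freeI (dumR q eq) (iparl f) = iparl f
  basic-freeI (dumR q {σ = σ} eq) (iparr f) =
    Sum.[ iparr , Sum.[ iparl , iparA ] ] (dummett-freeI {σ = σ} q eq f)

  contract⊢ : ∀ {Γ x y C} → Contract x y → Γ ⊢ x ∶ C → Γ ⊢ y ∶ C
  contract⊢ (cApp {σ = σ} r) = stack⊢ (basic⊢ r) σ
  contract⊢ (cPar r)         = basic⊢ r

  contract-freeP : ∀ {x y k} → Contract x y → FreeP k y → FreeP k x
  contract-freeP (cApp {σ = σ} r) = stack-freeP (basic-freeP r) σ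
  contract-freeP (cPar r)         = basic-freeP r

  contract-freeI : ∀ {x y α} → Contract x y → FreeI α y → FreeI α x
  contract-freeI (cApp {σ = σ} r) = stack-freeI (basic-freeI r) σ
  contract-freeI (cPar r)         = basic-freeI r

theorem2p7 : (S : Signature) → let open LC S in
    ∀ {Γ : List Fm} {t u : PT} {C : Fm} →
    Γ ⊢ t ∶ C → t ≻ u →
    (Γ ⊢ u ∶ C) × (∀ i → FreeP i u → FreeP i t) × (∀ α → FreeI α u → FreeI α t)
theorem2p7 S d (LC.hstep p _ _ _ c) =
    refill⊢ (contract⊢ c focus⊢)
  , (λ i → refill-freeP p (contract-freeP c))
  , (λ α → refill-freeI p (contract-freeI c))
  where
  open HeadReduction S
  open Focus (focus-at d p)
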